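{- Let $G$ be a finite simple graph with minimum degree $\delta$, and suppose there exists a set of vertices $K = \{v_1,\dots,v_k\}$ such that the graph $G\setminus K$ (obtained by deleting the vertices of $K$) has minimum degree at least $2$ and girth at least $5$. Then $2\delta - 3k - 2 \le Z(G)$.
   Context: The girth is the length of a shortest cycle. Zero forcing process: start with an initial set $S$ of colored vertices. A colored vertex $u$ forces an uncolored neighbor $w$ (making $w$ colored) if $w$ is the only uncolored neighbor of $u$; forces are applied repeatedly. $S$ is a zero forcing set if eventually every vertex becomes colored. $Z(G)$ is the minimum size of a zero forcing set. -}

module Defs where

open import Data.Nat using (ℕ; _≤_; _<_)
open import Data.Bool using (Bool; true; false)
open import Data.Fin using (Fin)
open import Data.Fin.Subset using (Subset; _∈_; _∉_; ∣_∣; _∩_; ∁)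
open import Data.Vec using (tabulate; lookup)
open import Data.Product using (Σ; ∃; _×_)
open import Relation.Binary.PropositionalEquality using (_≡_; _≢_)
open import Relation.Nullary using (¬_)

record Graph (n : ℕ) : Set where
  field
    adj       : Fin n → Fin n → Bool
    adj-sym   : ∀ u v → adj u v ≡ adj v u
    adj-irref : ∀ v → adj v v ≡ false

module _ {n : ℕ} (G : Graph n) where
  open Graph G

  Adj : Fin n → Fin n → Set
  Adj u v = adj u v ≡ true

  N : Fin n → Subset n
  N v = tabulate (adj v)

  deg : Fin n → ℕ
  deg v = ∣ N v ∣

  IsMinDegree : ℕ → Set
  IsMinDegree δ = (∀ v → δ ≤ deg v) × (∃ λ v → deg v ≡ δ)

  degWithout : Subset n → Fin n → ℕ
  degWithout K v = ∣ N v ∩ ∁ K ∣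

  MinDegWithoutAtLeast2 : Subset n → Set
  MinDegWithoutAtLeast2 K = ∀ v → v ∉ K → 2 ≤ degWithout K v

  record CycleWithout (K : Subset n) (l : ℕ) : Set where
    field
      len≥3    : 3 ≤ l
      c        : ℕ → Fin n
      distinct : ∀ i j → i < l → j < l → c i ≡ c j → i ≡ j
      outside  : ∀ i → i < l → c i ∉ K
      step     : ∀ i → Data.Nat.suc i < l → Adj (c i) (c (Data.Nat.suc i))
      close    : ∀ l' → l ≡ Data.Nat.suc l' → Adj (c l') (c 0)

  -- girth of G ∖ K is at least g: every cycle has length at least g
  -- (an acyclic graph has infinite girth)
  GirthWithoutAtLeast : Subset n → ℕ → Set
  GirthWithoutAtLeast K g = ∀ l → CycleWithout K l → g ≤ l

  -- Zero forcing: the set of vertices eventually coloured starting from S.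
  -- A coloured vertex u forces a neighbour w when every other neighbour of u
  -- is coloured.
  data Coloured (S : Subset n) : Fin n → Set where
    init  : ∀ {v} → v ∈ S → Coloured S v
    force : ∀ {u w} → Coloured S u → Adj u w
          → (∀ x → Adj u x → x ≢ w → Coloured S x)
          → Coloured S w

  IsZeroForcingSet : Subset n → Set
  IsZeroForcingSet S = ∀ v → Coloured S v

  IsZeroForcingNumber : ℕ → Set
  IsZeroForcingNumber z =
    (∃ λ S → IsZeroForcingSet S × ∣ S ∣ ≡ z) ×
    (∀ S → IsZeroForcingSet S → z ≤ ∣ S ∣)

module Submission where

-- Let S be a zero forcing set and k = ∣ K ∣.  Run the forcing process for
-- k + 2 steps.  Afterwards a set R with ∣ R ∣ ≤ ∣ S ∣ + k + 2 is coloured,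
-- and the set T of vertices that have forced is contained in R and consists
-- of saturated vertices (all their neighbours lie in R); T has k + 2
-- elements, or the process stopped early and then every vertex is coloured
-- and saturated.  Unless G has at most k + 1 vertices (when δ ≤ k trivially),
-- two distinct vertices a, u of T lie outside K.  As G ∖ K has no triangles
-- and no 4-cycles, the neighbourhoods of a and u in G ∖ K share no vertex when
-- a ~ u, and at most one otherwise, in which case a is an extra vertex of R
-- outside both.  Each such neighbourhood has at least δ − k vertices, hence
-- 2δ − 2k ≤ ∣ R ∣ ≤ Z(G) + k + 2.

open import Defs
open import Data.Nat using (ℕ; zero; suc; _+_; _*_; _∸_; _≤_; _<_; _≤?_; z≤n; s≤s)
open import Data.Nat.Properties
  using (≤-refl; ≤-reflexive; ≤-trans; ≤-pred; ≰⇒>; +-identityʳ; +-comm; +-suc;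
         +-mono-≤; +-monoˡ-≤; +-monoʳ-≤; +-cancelˡ-≤; *-monoˡ-≤; *-monoʳ-≤; ∸-monoˡ-≤; m≤m+n; m≤n+m; <-cmp; module ≤-Reasoning)
open import Data.Nat.Tactic.RingSolver using (solve-∀)
open import Data.Bool using (true; false)
import Data.Bool as Bool
open import Data.Vec using ([]; _∷_; tabulate)
open import Data.Vec.Properties using (lookup∘tabulate; []=⇒lookup; lookup⇒[]=)
open import Data.Fin using (Fin; _≟_)
open import Data.Fin.Properties using (any?; all?; ¬∀⟶∃¬)
open import Data.Fin.Subset
open import Data.Fin.Subset.Properties
open import Data.Integer as ℤ using ()
import Data.Integer.Properties as ℤP
import Data.Integer.Tactic.RingSolver as ℤSolver
open import Data.Product using (∃; ∃₂; _×_; _,_; proj₁)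
open import Data.Sum using (_⊎_; inj₁; inj₂)
open import Data.Empty using () renaming (⊥ to False; ⊥-elim to False-elim)
open import Function using (_∘_; id)
open import Relation.Binary.Definitions using (tri<; tri≈; tri>)
open import Relation.Nullary using (¬_; Dec; yes; no; contradiction)
open import Relation.Nullary.Decidable using (_×-dec_; ¬?; decidable-stable)
open import Relation.Binary.PropositionalEquality
  using (_≡_; _≢_; refl; sym; trans; cong; subst; module ≡-Reasoning)

all-or-counterexample : ∀ {n} {P Q : Fin n → Set} →
  (∀ x → Dec (P x)) → (∀ x → Dec (Q x)) →
  (∀ x → P x → Q x) ⊎ ∃ λ x → P x × ¬ Q x
all-or-counterexample P? Q? with any? (λ x → P? x ×-dec ¬? (Q? x))
... | yes counterexample = inj₂ counterexample
... | no none = inj₁ λ x px → decidable-stable (Q? x) λ ¬qx → none (x , px , ¬qx)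

injective-below : ∀ {A : Set} (c : ℕ → A) (l : ℕ) →
  (∀ {i j} → i < j → j < l → c i ≢ c j) →
  ∀ i j → i < l → j < l → c i ≡ c j → i ≡ j
injective-below c l differ i j i<l j<l ci≡cj with <-cmp i j
... | tri< i<j _ _ = False-elim (differ i<j j<l ci≡cj)
... | tri≈ _ i≡j _ = i≡j
... | tri> _ _ j<i = False-elim (differ j<i i<l (sym ci≡cj))

inclusion-exclusion : ∀ {n} (p q : Subset n) → ∣ p ∪ q ∣ + ∣ p ∩ q ∣ ≡ ∣ p ∣ + ∣ q ∣
inclusion-exclusion [] [] = refl
inclusion-exclusion (true ∷ p) (true ∷ q) =
  cong suc (trans (+-suc _ _) (trans (cong suc (inclusion-exclusion p q)) (sym (+-suc _ _))))
inclusion-exclusion (true ∷ p) (false ∷ q) = cong suc (inclusion-exclusion p q)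
inclusion-exclusion (false ∷ p) (true ∷ q) = trans (cong suc (inclusion-exclusion p q)) (sym (+-suc _ _))
inclusion-exclusion (false ∷ p) (false ∷ q) = inclusion-exclusion p q

∣p∪q∣≤∣p∣+∣q∣ : ∀ {n} (p q : Subset n) → ∣ p ∪ q ∣ ≤ ∣ p ∣ + ∣ q ∣
∣p∪q∣≤∣p∣+∣q∣ p q = ≤-trans (m≤m+n _ _) (≤-reflexive (inclusion-exclusion p q))

Empty⇒∣p∣≡0 : ∀ {n} {p : Subset n} → Empty p → ∣ p ∣ ≡ 0
Empty⇒∣p∣≡0 {n} empty = trans (cong ∣_∣ (Empty-unique empty)) (∣⊥∣≡0 n)

disjoint-∪ : ∀ {n} (p q : Subset n) → Empty (p ∩ q) → ∣ p ∪ q ∣ ≡ ∣ p ∣ + ∣ q ∣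
disjoint-∪ p q disjoint = begin
  ∣ p ∪ q ∣                ≡⟨ sym (+-identityʳ _) ⟩
  ∣ p ∪ q ∣ + 0            ≡⟨ cong (∣ p ∪ q ∣ +_) (sym (Empty⇒∣p∣≡0 disjoint)) ⟩
  ∣ p ∪ q ∣ + ∣ p ∩ q ∣    ≡⟨ inclusion-exclusion p q ⟩
  ∣ p ∣ + ∣ q ∣            ∎
  where open ≡-Reasoning

∣p∪⁅x⁆∣≤∣p∣+1 : ∀ {n} (p : Subset n) x → ∣ p ∪ ⁅ x ⁆ ∣ ≤ ∣ p ∣ + 1
∣p∪⁅x⁆∣≤∣p∣+1 p x = ≤-trans (∣p∪q∣≤∣p∣+∣q∣ p ⁅ x ⁆) (≤-reflexive (cong (∣ p ∣ +_) (∣⁅x⁆∣≡1 x)))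

∣p∪⁅x⁆∣≡∣p∣+1 : ∀ {n} (p : Subset n) x → x ∉ p → ∣ p ∪ ⁅ x ⁆ ∣ ≡ ∣ p ∣ + 1
∣p∪⁅x⁆∣≡∣p∣+1 p x x∉p =
  trans (disjoint-∪ p ⁅ x ⁆ disjoint) (cong (∣ p ∣ +_) (∣⁅x⁆∣≡1 x))
  where
  disjoint : Empty (p ∩ ⁅ x ⁆)
  disjoint (y , y∈p∩⁅x⁆) with x∈p∩q⁻ p ⁅ x ⁆ y∈p∩⁅x⁆
  ... | y∈p , y∈⁅x⁆ = x∉p (subst (_∈ p) (x∈⁅y⁆⇒x≡y x y∈⁅x⁆) y∈p)

∈∪⁅x⁆ˡ : ∀ {n} {p : Subset n} {y} x → y ∈ p → y ∈ p ∪ ⁅ x ⁆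
∈∪⁅x⁆ˡ x y∈p = x∈p∪q⁺ (inj₁ y∈p)

∈∪⁅x⁆ʳ : ∀ {n} (p : Subset n) x → x ∈ p ∪ ⁅ x ⁆
∈∪⁅x⁆ʳ p x = x∈p∪q⁺ (inj₂ (x∈⁅x⁆ x))

two-elements : ∀ {n} (p : Subset n) → 2 ≤ ∣ p ∣ → ∃₂ λ a b → a ∈ p × b ∈ p × a ≢ b
two-elements p 2≤∣p∣ with nonempty? p
... | no empty = contradiction (subst (2 ≤_) (Empty⇒∣p∣≡0 empty) 2≤∣p∣) λ ()
... | yes (a , a∈p) with any? (λ b → b ∈? p ×-dec ¬? (a ≟ b))
...   | yes (b , b∈p , a≢b) = a , b , a∈p , b∈p , a≢b
...   | no none = False-elim (2≰1 (≤-trans 2≤∣p∣ ∣p∣≤1))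
  where
  p⊆⁅a⁆ : p ⊆ ⁅ a ⁆
  p⊆⁅a⁆ {b} b∈p with a ≟ b
  ... | yes refl = x∈⁅x⁆ a
  ... | no a≢b = False-elim (none (b , b∈p , a≢b))
  ∣p∣≤1 : ∣ p ∣ ≤ 1
  ∣p∣≤1 = ≤-trans (p⊆q⇒∣p∣≤∣q∣ p⊆⁅a⁆) (≤-reflexive (∣⁅x⁆∣≡1 a))
  2≰1 : ¬ (2 ≤ 1)
  2≰1 (s≤s ())

∣p∣≤∣q∣+∣p∖q∣ : ∀ {n} (p q : Subset n) → ∣ p ∣ ≤ ∣ q ∣ + ∣ p ∩ ∁ q ∣
∣p∣≤∣q∣+∣p∖q∣ p q = ≤-trans (p⊆q⇒∣p∣≤∣q∣ p⊆q∪p∖q) (∣p∪q∣≤∣p∣+∣q∣ q (p ∩ ∁ q))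
  where
  p⊆q∪p∖q : p ⊆ q ∪ (p ∩ ∁ q)
  p⊆q∪p∖q {x} x∈p with x ∈? q
  ... | yes x∈q = x∈p∪q⁺ (inj₁ x∈q)
  ... | no x∉q = x∈p∪q⁺ (inj₂ (x∈p∩q⁺ (x∈p , x∉p⇒x∈∁p x∉q)))

two-outside : ∀ {n} (T K : Subset n) → 2 + ∣ K ∣ ≤ ∣ T ∣ →
  ∃₂ λ a b → (a ∈ T × a ∉ K) × (b ∈ T × b ∉ K) × a ≢ b
two-outside T K bound with two-elements (T ∩ ∁ K) 2≤∣T∖K∣
  where
  2≤∣T∖K∣ : 2 ≤ ∣ T ∩ ∁ K ∣
  2≤∣T∖K∣ = +-cancelˡ-≤ ∣ K ∣ 2 _
    (≤-trans (≤-reflexive (+-comm ∣ K ∣ 2)) (≤-trans bound (∣p∣≤∣q∣+∣p∖q∣ T K)))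
... | a , b , a∈ , b∈ , a≢b = a , b , ∈T∖K⁻ a∈ , ∈T∖K⁻ b∈ , a≢b
  where
  ∈T∖K⁻ : ∀ {x} → x ∈ T ∩ ∁ K → x ∈ T × x ∉ K
  ∈T∖K⁻ {x} x∈ with x∈p∩q⁻ T (∁ K) x∈
  ... | x∈T , x∈∁K = x∈T , x∈∁p⇒x∉p x∈∁K

module _ {n : ℕ} (G : Graph n) where
  open Graph G

  adj⇒≢ : ∀ {x y} → Adj G x y → x ≢ y
  adj⇒≢ {x} x~y refl with trans (sym x~y) (adj-irref x)
  ... | ()

  adj-symm : ∀ {x y} → Adj G x y → Adj G y x
  adj-symm {x} {y} x~y = trans (adj-sym y x) x~y

  adj? : ∀ u x → Dec (Adj G u x)
  adj? u x = adj u x Bool.≟ true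

  Adj⇒∈N : ∀ {v x} → Adj G v x → x ∈ N G v
  Adj⇒∈N {v} {x} v~x = lookup⇒[]= x (tabulate (adj v)) (trans (lookup∘tabulate (adj v) x) v~x)

  ∈N⇒Adj : ∀ {v x} → x ∈ N G v → Adj G v x
  ∈N⇒Adj {v} {x} x∈N = trans (sym (lookup∘tabulate (adj v) x)) ([]=⇒lookup x∈N)

  -- A vertex is not its own neighbour, so its degree is at most n − 1;
  -- in particular all degrees are at most k when n ≤ k + 1.
  few-vertices : ∀ {k} → n ≤ suc k → ∀ v → deg G v ≤ k
  few-vertices {k} n≤1+k v = begin
    ∣ N G v ∣       ≤⟨ p⊆q⇒∣p∣≤∣q∣ N⊆∁⁅v⁆ ⟩
    ∣ ∁ ⁅ v ⁆ ∣     ≡⟨ ∣∁p∣≡n∸∣p∣ ⁅ v ⁆ ⟩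
    n ∸ ∣ ⁅ v ⁆ ∣   ≡⟨ cong (n ∸_) (∣⁅x⁆∣≡1 v) ⟩
    n ∸ 1           ≤⟨ ∸-monoˡ-≤ 1 n≤1+k ⟩
    k               ∎
    where
    open ≤-Reasoning
    N⊆∁⁅v⁆ : N G v ⊆ ∁ ⁅ v ⁆
    N⊆∁⁅v⁆ x∈N = x∉p⇒x∈∁p λ x∈⁅v⁆ → adj⇒≢ (∈N⇒Adj x∈N) (sym (x∈⁅y⁆⇒x≡y v x∈⁅v⁆))

  coloured-mono : ∀ {S R v} → S ⊆ R → Coloured G S v → Coloured G R v
  coloured-mono S⊆R (init v∈S) = init (S⊆R v∈S)
  coloured-mono S⊆R (force cu u~w rest) =
    force (coloured-mono S⊆R cu) u~w (λ x u~x x≢w → coloured-mono S⊆R (rest x u~x x≢w))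

  Saturated : Subset n → Fin n → Set
  Saturated R u = ∀ x → Adj G u x → x ∈ R

  record ValidForce (R : Subset n) : Set where
    field
      u w    : Fin n
      u∈R    : u ∈ R
      u~w    : Adj G u w
      w∉R    : w ∉ R
      others : ∀ x → Adj G u x → x ≢ w → x ∈ R

  -- If w is coloured starting from R but w ∉ R, the derivation of w
  -- contains a force that is already valid for R: its first step leaving R.
  valid-force-from : ∀ {R w} → Coloured G R w → w ∉ R → ValidForce R
  valid-force-from (init w∈R) w∉R = False-elim (w∉R w∈R)
  valid-force-from {R} {w} (force {u} cu u~w rest) w∉R with u ∈? R
  ... | no u∉R = valid-force-from cu u∉R
  ... | yes u∈R with all-or-counterexample (λ x → adj? u x ×-dec ¬? (x ≟ w)) (_∈? R)
  ...   | inj₁ others = record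
          { u = u ; w = w ; u∈R = u∈R ; u~w = u~w ; w∉R = w∉R
          ; others = λ x u~x x≢w → others x (u~x , x≢w) }
  ...   | inj₂ (x , (u~x , x≢w) , x∉R) = valid-force-from (rest x u~x x≢w) x∉R

  finished-or-force : ∀ {R} → IsZeroForcingSet G R → (∀ v → v ∈ R) ⊎ ValidForce R
  finished-or-force {R} R-forcing with all? (_∈? R)
  ... | yes all∈R = inj₁ all∈R
  ... | no ¬all∈R with ¬∀⟶∃¬ n (_∈ R) (_∈? R) ¬all∈R
  ...   | w , w∉R = inj₂ (valid-force-from (R-forcing w) w∉R)

  -- The state of the forcing process from S after t steps: the coloured set R
  -- and the set T of vertices that have forced (all saturated).
  record Run (S : Subset n) (t : ℕ) : Set where
    field
      R T         : Subset n
      S⊆R         : S ⊆ R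
      T⊆R         : T ⊆ R
      T-saturated : ∀ {u} → u ∈ T → Saturated R u
      R-size      : ∣ R ∣ ≤ ∣ S ∣ + t
      progress    : t ≤ ∣ T ∣ ⊎ T ≡ ⊤

  finished-run : ∀ {S t} (R : Subset n) → S ⊆ R → (∀ v → v ∈ R) → ∣ R ∣ ≤ ∣ S ∣ + t → Run S t
  finished-run R S⊆R all∈R R-size = record
    { R = R ; T = ⊤ ; S⊆R = S⊆R ; T⊆R = λ {v} _ → all∈R v
    ; T-saturated = λ _ x _ → all∈R x ; R-size = R-size ; progress = inj₂ refl }

  -- Performing a valid force u → w colours w, after which u is saturated.
  -- The forcing vertex u is new to T, as the vertices of T have no neighbour outside R.
  perform : ∀ {S t} (r : Run S t) → ValidForce (Run.R r) → Run S (suc t)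
  perform {S} {t} r f = record
    { R = R ∪ ⁅ w ⁆ ; T = T ∪ ⁅ u ⁆
    ; S⊆R = ∈∪⁅x⁆ˡ w ∘ S⊆R
    ; T⊆R = T′⊆R′ ; T-saturated = T′-saturated ; R-size = R′-size ; progress = inj₁ T′-size }
    where
    open Run r
    open ValidForce f
    u∉T : u ∉ T
    u∉T u∈T = w∉R (T-saturated u∈T w u~w)
    ∈T∪⁅u⁆ : ∀ {x} → x ∈ T ∪ ⁅ u ⁆ → x ∈ T ⊎ x ≡ u
    ∈T∪⁅u⁆ {x} x∈ with x∈p∪q⁻ T ⁅ u ⁆ x∈
    ... | inj₁ x∈T = inj₁ x∈T
    ... | inj₂ x∈⁅u⁆ = inj₂ (x∈⁅y⁆⇒x≡y u x∈⁅u⁆)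
    T′⊆R′ : T ∪ ⁅ u ⁆ ⊆ R ∪ ⁅ w ⁆
    T′⊆R′ x∈ with ∈T∪⁅u⁆ x∈
    ... | inj₁ x∈T = ∈∪⁅x⁆ˡ w (T⊆R x∈T)
    ... | inj₂ refl = ∈∪⁅x⁆ˡ w u∈R
    T′-saturated : ∀ {v} → v ∈ T ∪ ⁅ u ⁆ → Saturated (R ∪ ⁅ w ⁆) v
    T′-saturated v∈ x v~x with ∈T∪⁅u⁆ v∈ | x ≟ w
    ... | inj₁ v∈T | _ = ∈∪⁅x⁆ˡ w (T-saturated v∈T x v~x)
    ... | inj₂ refl | yes refl = ∈∪⁅x⁆ʳ R w
    ... | inj₂ refl | no x≢w = ∈∪⁅x⁆ˡ w (others x v~x x≢w)
    R′-size : ∣ R ∪ ⁅ w ⁆ ∣ ≤ ∣ S ∣ + suc t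
    R′-size = ≤-trans (∣p∪⁅x⁆∣≤∣p∣+1 R w)
              (≤-trans (+-monoˡ-≤ 1 R-size) (≤-reflexive (trans (+-comm (∣ S ∣ + t) 1) (sym (+-suc ∣ S ∣ t)))))
    T′-size : suc t ≤ ∣ T ∪ ⁅ u ⁆ ∣
    T′-size with progress
    ... | inj₂ refl = False-elim (u∉T ∈⊤)
    ... | inj₁ t≤∣T∣ =
      ≤-trans (≤-reflexive (+-comm 1 t)) (≤-trans (+-monoˡ-≤ 1 t≤∣T∣) (≤-reflexive (sym (∣p∪⁅x⁆∣≡∣p∣+1 T u u∉T))))

  run : ∀ {S} → IsZeroForcingSet G S → ∀ t → Run S t
  run {S} S-forcing zero = record
    { R = S ; T = ⊥ ; S⊆R = id ; T⊆R = False-elim ∘ ∉⊥ ; T-saturated = False-elim ∘ ∉⊥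
    ; R-size = ≤-reflexive (sym (+-identityʳ ∣ S ∣)) ; progress = inj₁ z≤n }
  run {S} S-forcing (suc t) with run S-forcing t
  ... | r with finished-or-force (λ v → coloured-mono (Run.S⊆R r) (S-forcing v))
  ...   | inj₁ all∈R = finished-run (Run.R r) (Run.S⊆R r) all∈R (≤-trans (Run.R-size r) (+-monoʳ-≤ ∣ S ∣ (m≤n+m t 1)))
  ...   | inj₂ f = perform r f

  -- After t ≤ n steps at least t vertices have forced: if the process has
  -- finished, all n vertices count as having forced.
  forcers-size : ∀ {S t} → t ≤ n → (r : Run S t) → t ≤ ∣ Run.T r ∣
  forcers-size t≤n r with Run.progress r
  ... | inj₁ t≤∣T∣ = t≤∣T∣
  ... | inj₂ refl = ≤-trans t≤n (≤-reflexive (sym (∣⊤∣≡n n)))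

module _ {n : ℕ} (G : Graph n) (K : Subset n) where

  outerN : Fin n → Subset n
  outerN v = N G v ∩ ∁ K

  ∈outerN⁺ : ∀ {v x} → Adj G v x → x ∉ K → x ∈ outerN v
  ∈outerN⁺ v~x x∉K = x∈p∩q⁺ (Adj⇒∈N G v~x , x∉p⇒x∈∁p x∉K)

  ∈outerN⁻ : ∀ {v x} → x ∈ outerN v → Adj G v x × x ∉ K
  ∈outerN⁻ {v} x∈ with x∈p∩q⁻ (N G v) (∁ K) x∈
  ... | x∈N , x∈∁K = ∈N⇒Adj G x∈N , x∈∁p⇒x∉p x∈∁K

  deg≤outer+∣K∣ : ∀ v → deg G v ≤ ∣ outerN v ∣ + ∣ K ∣
  deg≤outer+∣K∣ v = ≤-trans (p⊆q⇒∣p∣≤∣q∣ N⊆outer∪K) (∣p∪q∣≤∣p∣+∣q∣ (outerN v) K)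
    where
    N⊆outer∪K : N G v ⊆ outerN v ∪ K
    N⊆outer∪K {x} x∈N with x ∈? K
    ... | yes x∈K = x∈p∪q⁺ (inj₂ x∈K)
    ... | no x∉K = x∈p∪q⁺ (inj₁ (∈outerN⁺ (∈N⇒Adj G x∈N) x∉K))

  module _ (girth5 : GirthWithoutAtLeast G K 5) where

    no-triangle : ∀ {x y w} → x ∉ K → y ∉ K → w ∉ K →
      Adj G x y → Adj G y w → Adj G w x → False
    no-triangle {x} {y} {w} x∉K y∉K w∉K x~y y~w w~x = 5≰3 (girth5 3 triangle)
      where
      5≰3 : ¬ (5 ≤ 3)
      5≰3 (s≤s (s≤s (s≤s ())))
      c : ℕ → Fin n
      c 0 = x
      c 1 = y
      c _ = w
      differ : ∀ {i j} → i < j → j < 3 → c i ≢ c j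
      differ {0} {1} _ _ = adj⇒≢ G x~y
      differ {0} {2} _ _ = adj⇒≢ G w~x ∘ sym
      differ {1} {2} _ _ = adj⇒≢ G y~w
      differ {_} {suc (suc (suc _))} _ (s≤s (s≤s (s≤s ())))
      differ {suc (suc _)} {2} (s≤s (s≤s ())) _
      differ {suc _} {1} (s≤s ()) _
      off-K : ∀ i → i < 3 → c i ∉ K
      off-K 0 _ = x∉K
      off-K 1 _ = y∉K
      off-K 2 _ = w∉K
      off-K (suc (suc (suc _))) (s≤s (s≤s (s≤s ())))
      step : ∀ i → suc i < 3 → Adj G (c i) (c (suc i))
      step 0 _ = x~y
      step 1 _ = y~w
      step (suc (suc _)) (s≤s (s≤s (s≤s ())))
      close : ∀ l′ → 3 ≡ suc l′ → Adj G (c l′) (c 0)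
      close .2 refl = w~x
      triangle : CycleWithout G K 3
      triangle = record
        { len≥3 = ≤-refl ; c = c ; distinct = injective-below c 3 differ
        ; outside = off-K ; step = step ; close = close }

    no-square : ∀ {a b c d} → a ∉ K → b ∉ K → c ∉ K → d ∉ K →
      Adj G a b → Adj G b c → Adj G c d → Adj G d a → a ≢ c → b ≢ d → False
    no-square {a} {b} {c} {d} a∉K b∉K c∉K d∉K a~b b~c c~d d~a a≢c b≢d = 5≰4 (girth5 4 square)
      where
      5≰4 : ¬ (5 ≤ 4)
      5≰4 (s≤s (s≤s (s≤s (s≤s ()))))
      v : ℕ → Fin n
      v 0 = a
      v 1 = b
      v 2 = c
      v _ = d
      differ : ∀ {i j} → i < j → j < 4 → v i ≢ v j
      differ {0} {1} _ _ = adj⇒≢ G a~b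
      differ {0} {2} _ _ = a≢c
      differ {0} {3} _ _ = adj⇒≢ G d~a ∘ sym
      differ {1} {2} _ _ = adj⇒≢ G b~c
      differ {1} {3} _ _ = b≢d
      differ {2} {3} _ _ = adj⇒≢ G c~d
      differ {_} {suc (suc (suc (suc _)))} _ (s≤s (s≤s (s≤s (s≤s ()))))
      differ {suc (suc (suc _))} {3} (s≤s (s≤s (s≤s ()))) _
      differ {suc (suc _)} {2} (s≤s (s≤s ())) _
      differ {suc _} {1} (s≤s ()) _
      off-K : ∀ i → i < 4 → v i ∉ K
      off-K 0 _ = a∉K
      off-K 1 _ = b∉K
      off-K 2 _ = c∉K
      off-K 3 _ = d∉K
      off-K (suc (suc (suc (suc _)))) (s≤s (s≤s (s≤s (s≤s ()))))
      step : ∀ i → suc i < 4 → Adj G (v i) (v (suc i))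
      step 0 _ = a~b
      step 1 _ = b~c
      step 2 _ = c~d
      step (suc (suc (suc _))) (s≤s (s≤s (s≤s (s≤s ()))))
      close : ∀ l′ → 4 ≡ suc l′ → Adj G (v l′) (v 0)
      close .3 refl = d~a
      square : CycleWithout G K 4
      square = record
        { len≥3 = s≤s (s≤s (s≤s z≤n)) ; c = v ; distinct = injective-below v 4 differ
        ; outside = off-K ; step = step ; close = close }

    -- Adjacent vertices of G ∖ K have no common neighbour there (no triangles).
    adjacent⇒disjoint : ∀ {a u} → a ∉ K → u ∉ K → Adj G a u → Empty (outerN a ∩ outerN u)
    adjacent⇒disjoint {a} {u} a∉K u∉K a~u (x , x∈) with x∈p∩q⁻ (outerN a) (outerN u) x∈
    ... | x∈Na , x∈Nu with ∈outerN⁻ x∈Na | ∈outerN⁻ x∈Nu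
    ... | a~x , x∉K | u~x , _ = no-triangle a∉K x∉K u∉K a~x (adj-symm G u~x) (adj-symm G a~u)

    -- Distinct vertices of G ∖ K have at most one common neighbour there (no 4-cycles).
    common-outerN≤1 : ∀ {a u} → a ≢ u → a ∉ K → u ∉ K → ∣ outerN a ∩ outerN u ∣ ≤ 1
    common-outerN≤1 {a} {u} a≢u a∉K u∉K with 2 ≤? ∣ outerN a ∩ outerN u ∣
    ... | no ≱2 = ≤-pred (≰⇒> ≱2)
    ... | yes 2≤ with two-elements (outerN a ∩ outerN u) 2≤
    ... | x , y , x∈ , y∈ , x≢y with x∈p∩q⁻ (outerN a) (outerN u) x∈ | x∈p∩q⁻ (outerN a) (outerN u) y∈
    ... | x∈Na , x∈Nu | y∈Na , y∈Nu with ∈outerN⁻ x∈Na | ∈outerN⁻ x∈Nu | ∈outerN⁻ y∈Na | ∈outerN⁻ y∈Nu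
    ... | a~x , x∉K | u~x , _ | a~y , y∉K | u~y , _ =
      False-elim (no-square a∉K x∉K u∉K y∉K a~x (adj-symm G u~x) u~y (adj-symm G a~y) a≢u x≢y)

    pair-bound : ∀ {a u} → a ≢ u → a ∉ K → u ∉ K →
      ∣ outerN a ∣ + ∣ outerN u ∣ ≤ ∣ (outerN a ∪ outerN u) ∪ ⁅ a ⁆ ∣
    pair-bound {a} {u} a≢u a∉K u∉K with adj? G a u
    ... | yes a~u = begin
      ∣ outerN a ∣ + ∣ outerN u ∣     ≡⟨ sym (disjoint-∪ (outerN a) (outerN u) (adjacent⇒disjoint a∉K u∉K a~u)) ⟩
      ∣ outerN a ∪ outerN u ∣         ≤⟨ ∣p∣≤∣p∪q∣ (outerN a ∪ outerN u) ⁅ a ⁆ ⟩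
      ∣ (outerN a ∪ outerN u) ∪ ⁅ a ⁆ ∣ ∎
      where open ≤-Reasoning
    ... | no ¬a~u = begin
      ∣ outerN a ∣ + ∣ outerN u ∣                           ≡⟨ sym (inclusion-exclusion (outerN a) (outerN u)) ⟩
      ∣ outerN a ∪ outerN u ∣ + ∣ outerN a ∩ outerN u ∣     ≤⟨ +-monoʳ-≤ ∣ outerN a ∪ outerN u ∣ (common-outerN≤1 a≢u a∉K u∉K) ⟩
      ∣ outerN a ∪ outerN u ∣ + 1                           ≡⟨ sym (∣p∪⁅x⁆∣≡∣p∣+1 (outerN a ∪ outerN u) a a∉outer) ⟩
      ∣ (outerN a ∪ outerN u) ∪ ⁅ a ⁆ ∣                     ∎
      where
      open ≤-Reasoning
      a∉outer : a ∉ outerN a ∪ outerN u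
      a∉outer a∈ with x∈p∪q⁻ (outerN a) (outerN u) a∈
      ... | inj₁ a∈Na = adj⇒≢ G (proj₁ (∈outerN⁻ a∈Na)) refl
      ... | inj₂ a∈Nu = ¬a~u (adj-symm G (proj₁ (∈outerN⁻ a∈Nu)))

    saturated-pair-bound : ∀ {R a u} → a ≢ u → a ∉ K → u ∉ K →
      a ∈ R → Saturated G R a → Saturated G R u →
      deg G a + deg G u ≤ ∣ R ∣ + 2 * ∣ K ∣
    saturated-pair-bound {R} {a} {u} a≢u a∉K u∉K a∈R a-sat u-sat = begin
      deg G a + deg G u                                       ≤⟨ +-mono-≤ (deg≤outer+∣K∣ a) (deg≤outer+∣K∣ u) ⟩
      (∣ outerN a ∣ + ∣ K ∣) + (∣ outerN u ∣ + ∣ K ∣)         ≡⟨ regroup (∣ outerN a ∣) (∣ outerN u ∣) (∣ K ∣) ⟩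
      (∣ outerN a ∣ + ∣ outerN u ∣) + 2 * ∣ K ∣               ≤⟨ +-monoˡ-≤ (2 * ∣ K ∣) (pair-bound a≢u a∉K u∉K) ⟩
      ∣ (outerN a ∪ outerN u) ∪ ⁅ a ⁆ ∣ + 2 * ∣ K ∣           ≤⟨ +-monoˡ-≤ (2 * ∣ K ∣) (p⊆q⇒∣p∣≤∣q∣ W⊆R) ⟩
      ∣ R ∣ + 2 * ∣ K ∣                                       ∎
      where
      open ≤-Reasoning
      regroup : ∀ x y k → (x + k) + (y + k) ≡ (x + y) + 2 * k
      regroup = solve-∀
      W⊆R : (outerN a ∪ outerN u) ∪ ⁅ a ⁆ ⊆ R
      W⊆R {x} x∈ with x∈p∪q⁻ (outerN a ∪ outerN u) ⁅ a ⁆ x∈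
      ... | inj₂ x∈⁅a⁆ = subst (_∈ R) (sym (x∈⁅y⁆⇒x≡y a x∈⁅a⁆)) a∈R
      ... | inj₁ x∈N with x∈p∪q⁻ (outerN a) (outerN u) x∈N
      ...   | inj₁ x∈Na = a-sat x (proj₁ (∈outerN⁻ x∈Na))
      ...   | inj₂ x∈Nu = u-sat x (proj₁ (∈outerN⁻ x∈Nu))

    zero-forcing-bound : ∀ {δ} → (∀ v → δ ≤ deg G v) → Fin n →
      ∀ S → IsZeroForcingSet G S → 2 * δ ≤ ∣ S ∣ + 3 * ∣ K ∣ + 2
    zero-forcing-bound {δ} δ≤deg v S S-forcing with 2 + ∣ K ∣ ≤? n
    ... | no few = begin
      2 * δ                    ≤⟨ *-monoʳ-≤ 2 (≤-trans (δ≤deg v) (few-vertices G (≤-pred (≰⇒> few)) v)) ⟩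
      2 * ∣ K ∣                ≤⟨ *-monoˡ-≤ ∣ K ∣ {2} {3} (s≤s (s≤s z≤n)) ⟩
      3 * ∣ K ∣                ≤⟨ m≤n+m (3 * ∣ K ∣) ∣ S ∣ ⟩
      ∣ S ∣ + 3 * ∣ K ∣        ≤⟨ m≤m+n _ 2 ⟩
      ∣ S ∣ + 3 * ∣ K ∣ + 2    ∎
      where open ≤-Reasoning
    ... | yes many with run G S-forcing (2 + ∣ K ∣)
    ... | r with two-outside (Run.T r) K (forcers-size G many r)
    ... | a , u , (a∈T , a∉K) , (u∈T , u∉K) , a≢u = begin
      2 * δ                                ≤⟨ +-mono-≤ (δ≤deg a) (+-mono-≤ (δ≤deg u) z≤n) ⟩
      deg G a + (deg G u + 0)              ≡⟨ cong (deg G a +_) (+-identityʳ _) ⟩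
      deg G a + deg G u                    ≤⟨ saturated-pair-bound a≢u a∉K u∉K (T⊆R a∈T) (T-saturated a∈T) (T-saturated u∈T) ⟩
      ∣ R ∣ + 2 * ∣ K ∣                    ≤⟨ +-monoˡ-≤ (2 * ∣ K ∣) R-size ⟩
      ∣ S ∣ + (2 + ∣ K ∣) + 2 * ∣ K ∣      ≡⟨ collect (∣ S ∣) (∣ K ∣) ⟩
      ∣ S ∣ + 3 * ∣ K ∣ + 2                ∎
      where
      open ≤-Reasoning
      open Run r
      collect : ∀ s k → s + (2 + k) + 2 * k ≡ s + 3 * k + 2
      collect = solve-∀

ℕ-bound⇒ℤ-bound : ∀ {a b c z} → a ≤ z + b + c → ℤ.+ a ℤ.- ℤ.+ b ℤ.- ℤ.+ c ℤ.≤ ℤ.+ z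
ℕ-bound⇒ℤ-bound {a} {b} {c} {z} a≤ = begin
  ℤ.+ a ℤ.- ℤ.+ b ℤ.- ℤ.+ c
    ≤⟨ ℤP.+-monoˡ-≤ (ℤ.- ℤ.+ c) (ℤP.+-monoˡ-≤ (ℤ.- ℤ.+ b) (ℤ.+≤+ a≤)) ⟩
  ℤ.+ (z + b + c) ℤ.- ℤ.+ b ℤ.- ℤ.+ c
    ≡⟨ cong (λ t → t ℤ.- ℤ.+ b ℤ.- ℤ.+ c) (trans (ℤP.pos-+ (z + b) c) (cong (ℤ._+ ℤ.+ c) (ℤP.pos-+ z b))) ⟩
  ℤ.+ z ℤ.+ ℤ.+ b ℤ.+ ℤ.+ c ℤ.- ℤ.+ b ℤ.- ℤ.+ c
    ≡⟨ cancel (ℤ.+ z) (ℤ.+ b) (ℤ.+ c) ⟩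
  ℤ.+ z ∎
  where
  open ℤP.≤-Reasoning
  cancel : ∀ x y w → x ℤ.+ y ℤ.+ w ℤ.- y ℤ.- w ≡ x
  cancel = ℤSolver.solve-∀

theorem7 : (n : ℕ) (G : Graph n) (δ : ℕ) → IsMinDegree G δ →
           (K : Subset n) (k : ℕ) → ∣ K ∣ ≡ k →
           MinDegWithoutAtLeast2 G K → GirthWithoutAtLeast G K 5 →
           (z : ℕ) → IsZeroForcingNumber G z →
           ℤ.+ (2 * δ) ℤ.- ℤ.+ (3 * k) ℤ.- ℤ.+ 2 ℤ.≤ ℤ.+ z
theorem7 n G δ (δ≤deg , v , _) K .(∣ K ∣) refl _ girth5 .(∣ S ∣) ((S , S-forcing , refl) , _) =
  ℕ-bound⇒ℤ-bound (zero-forcing-bound G K girth5 δ≤deg v S S-forcing)
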